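{- For graphs $G$ and $H$, $G\in Expand(H)$ if and only if there exists $f\in\mathcal F(H,G)$ with $|f(v)|\ge 1$ for all $v\in\mathcal V(G)$.
   Context: All graphs are finite, simple, undirected. For a graph $K$, $Expand(K)$ is the set of all graphs obtainable from $K$ by a finite sequence of the operations: (I) remove a vertex; (II) replace a vertex $v$ by a clique of arbitrary size, each new vertex joined to all neighbors of $v$; (III) add a new edge. $\mathcal I(H)$ is the set of independent sets of $H$ (including $\emptyset$); $\mathcal S,\mathcal T\in\mathcal I(H)$ are disconnected in $H$ if $\mathcal S\cap\mathcal T=\emptyset$ and $\mathcal S\cup\mathcal T\in\mathcal I(H)$. $\mathcal F(H,G)$ is the set of functions $f:\mathcal V(G)\to\mathcal I(H)$ such that $f(v_1),f(v_2)$ are disconnected in $H$ whenever $v_1\neq v_2$ are non-adjacent in $G$. -}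

module Defs where

open import Data.Nat using (ℕ; zero; suc; _+_; _≤_)
open import Data.Bool using (Bool; true; false; not; _∧_; _∨_)
open import Data.Bool.Properties using (∨-comm; ∧-comm)
open import Data.Fin using (Fin; zero; suc; punchIn; _↑ˡ_; splitAt; _≟_)
open import Data.Fin.Subset using (Subset; _∈_; _∩_; _∪_; Empty; ∣_∣)
open import Data.Sum using (_⊎_; inj₁; inj₂)
open import Data.Product using (Σ; _×_; _,_; Σ-syntax)
open import Relation.Nullary using (¬_; yes; no)
open import Relation.Nullary.Decidable using (⌊_⌋)
open import Relation.Binary.PropositionalEquality using (_≡_; refl; sym; _≢_)
open import Function.Bundles using (_↔_; Inverse)
open import Data.Empty using (⊥-elim)

record Graph : Set where
  constructor mkGraph
  field
    n      : ℕ
    Adj    : Fin n → Fin n → Bool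
    symAdj : ∀ u v → Adj u v ≡ Adj v u
    irrAdj : ∀ v → Adj v v ≡ false
open Graph public

V : Graph → Set
V G = Fin (n G)

record _≅_ (G G' : Graph) : Set where
  field
    iso     : Fin (n G) ↔ Fin (n G')
    presAdj : ∀ u v → Adj G u v ≡ Adj G' (Inverse.to iso u) (Inverse.to iso v)

removeVertex : (G : Graph) → V G → Graph
removeVertex (mkGraph (suc m) A s i) w =
  mkGraph m (λ x y → A (punchIn w x) (punchIn w y))
            (λ x y → s (punchIn w x) (punchIn w y))
            (λ x → i (punchIn w x))

-- Operation (II): replace vertex v by a clique of size k, each new vertex
-- joined to all neighbours of v.  Done by first adding k new vertices
-- (forming a clique, each adjacent to exactly the neighbours of v) and
-- then removing v.

private
  eqb : ∀ {k} → Fin k → Fin k → Bool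
  eqb i j = ⌊ i ≟ j ⌋

  eqb-sym : ∀ {k} (i j : Fin k) → eqb i j ≡ eqb j i
  eqb-sym i j with i ≟ j | j ≟ i
  ... | yes _ | yes _ = refl
  ... | no _  | no _  = refl
  ... | yes p | no q  = ⊥-elim (q (sym p))
  ... | no p  | yes q = ⊥-elim (p (sym q))

  eqb-refl : ∀ {k} (i : Fin k) → eqb i i ≡ true
  eqb-refl i with i ≟ i
  ... | yes _ = refl
  ... | no q  = ⊥-elim (q refl)

module _ (G : Graph) (v : V G) (k : ℕ) where
  private
    m = n G
    A = Adj G

  cliqueAdj : Fin (m + k) → Fin (m + k) → Bool
  cliqueAdj x y with splitAt m x | splitAt m y
  ... | inj₁ a | inj₁ b = A a b
  ... | inj₁ a | inj₂ _ = A v a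
  ... | inj₂ _ | inj₁ b = A v b
  ... | inj₂ i | inj₂ j = not (eqb i j)

  cliqueSym : ∀ x y → cliqueAdj x y ≡ cliqueAdj y x
  cliqueSym x y with splitAt m x | splitAt m y
  ... | inj₁ a | inj₁ b = symAdj G a b
  ... | inj₁ a | inj₂ _ = refl
  ... | inj₂ _ | inj₁ b = refl
  ... | inj₂ i | inj₂ j rewrite eqb-sym i j = refl

  cliqueIrr : ∀ x → cliqueAdj x x ≡ false
  cliqueIrr x with splitAt m x
  ... | inj₁ a = irrAdj G a
  ... | inj₂ i rewrite eqb-refl i = refl

  addClique : Graph
  addClique = mkGraph (m + k) cliqueAdj cliqueSym cliqueIrr

  replaceByClique : Graph
  replaceByClique = removeVertex addClique (v ↑ˡ k)

module _ (G : Graph) (u w : V G) (u≢w : u ≢ w) where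
  private A = Adj G

  edgeAdj : V G → V G → Bool
  edgeAdj x y = A x y ∨ ((eqb x u ∧ eqb y w) ∨ (eqb x w ∧ eqb y u))

  edgeSym : ∀ x y → edgeAdj x y ≡ edgeAdj y x
  edgeSym x y rewrite symAdj G x y
                    | ∧-comm (eqb x u) (eqb y w)
                    | ∧-comm (eqb x w) (eqb y u)
                    | ∨-comm (eqb y w ∧ eqb x u) (eqb y u ∧ eqb x w) = refl

  edgeIrr : ∀ x → edgeAdj x x ≡ false
  edgeIrr x rewrite irrAdj G x with x ≟ u | x ≟ w
  ... | yes refl | yes q = ⊥-elim (u≢w q)
  ... | yes _ | no _ = refl
  ... | no _ | yes _ = refl
  ... | no _ | no _ = refl

  addEdge : Graph
  addEdge = mkGraph (n G) edgeAdj edgeSym edgeIrr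

data Reach (K : Graph) : Graph → Set where
  start   : Reach K K
  opI     : ∀ {G} → Reach K G → (v : V G) → Reach K (removeVertex G v)
  opII    : ∀ {G} → Reach K G → (v : V G) (k : ℕ) → Reach K (replaceByClique G v k)
  opIII   : ∀ {G} → Reach K G → (u w : V G) (u≢w : u ≢ w) → Reach K (addEdge G u w u≢w)

Expand : Graph → Graph → Set
Expand K G = Σ[ G' ∈ Graph ] (Reach K G' × G' ≅ G)

Independent : (H : Graph) → Subset (n H) → Set
Independent H S = ∀ u v → u ∈ S → v ∈ S → Adj H u v ≡ false

Disconnected : (H : Graph) → Subset (n H) → Subset (n H) → Set
Disconnected H S T = Empty (S ∩ T) × Independent H (S ∪ T)

InF : (H G : Graph) → (V G → Subset (n H)) → Set
InF H G f = (∀ v → Independent H (f v))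
          × (∀ v₁ v₂ → v₁ ≢ v₂ → Adj G v₁ v₂ ≡ false → Disconnected H (f v₁) (f v₂))

-- Both conditions amount to a homomorphism g : V G → V H between the complements, i.e. a map
-- sending distinct non-adjacent vertices to distinct non-adjacent vertices: from f choose a point
-- of each f v, and conversely take f v = {g v}.  Each of (I)-(III) has such a map back to the graph
-- it was applied to (for (II), collapse the clique onto v), and these compose along Expand.
-- Conversely, given g, clone H along g one vertex of G at a time, each time replacing a spare
-- descendant of g v by a 2-clique.  The clones have no edges outside those of G, so deleting the
-- remaining vertices and adding the missing edges yields G.

module Submission where

open import Defs
open import Data.Bool using (Bool; true; false; _∨_)
open import Data.Bool.Properties using (∨-conicalˡ; ⇔→≡)
open import Data.Empty using (⊥-elim)
open import Data.Fin using (Fin; zero; suc; punchIn; punchOut; _↑ˡ_; _↑ʳ_; splitAt; join; _≟_)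
open import Data.Fin.Properties
  using (punchIn-injective; punchInᵢ≢i; punchIn-punchOut; punchOut-injective; ↑ˡ-injective; ↑ʳ-injective;
         splitAt-↑ˡ; splitAt-↑ʳ; join-splitAt; any?; all?; ¬∀⟶∃¬)
open import Data.Fin.Subset using (Subset; _∈_; _∩_; _∪_; Empty; ∣_∣; ⁅_⁆; Nonempty)
open import Data.Fin.Subset.Properties
  using (x∈⁅y⁆⇒x≡y; ∣⁅x⁆∣≡1; x∈p∩q⁻; x∈p∩q⁺; x∈p∪q⁻; x∈p∪q⁺; Empty-unique; ∣⊥∣≡0; nonempty?)
open import Data.List using (List; []; _∷_; allFin; cartesianProduct)
open import Data.List.Membership.Propositional using () renaming (_∈_ to _∈ₗ_)
open import Data.List.Membership.Propositional.Properties using (∈-allFin; ∈-cartesianProduct⁺)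
open import Data.List.Relation.Unary.Any using (here; there)
open import Data.Nat using (ℕ; zero; suc; _+_; _≤_)
open import Data.Nat.Properties using (n≮0; ≤-reflexive)
open import Data.Product using (Σ-syntax; _×_; _,_; proj₁; proj₂)
open import Data.Sum as Sum using (_⊎_; inj₁; inj₂; [_,_]′)
open import Function using (id; const; _∘_)
open import Function.Bundles using (_↔_; Inverse; _⇔_; mk⇔; mk↔ₛ′)
open import Relation.Nullary using (Dec; yes; no; contradiction)
open import Relation.Nullary.Decidable using (decidable-stable)
open import Relation.Binary.PropositionalEquality

private
  variable
    G H : Graph

-- Distinct and non-adjacent: adjacent in the complement of G.
NonAdjacent : (G : Graph) → V G → V G → Set
NonAdjacent G u v = u ≢ v × Adj G u v ≡ false

ComplementHom : (G H : Graph) → (V G → V H) → Set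
ComplementHom G H g = ∀ {u v} → NonAdjacent G u v → NonAdjacent H (g u) (g v)

ReflexiveHom : (G H : Graph) → (V G → V H) → Set
ReflexiveHom G H ℓ = ∀ {u v} → Adj G u v ≡ true → ℓ u ≡ ℓ v ⊎ Adj H (ℓ u) (ℓ v) ≡ true

ReflexiveHom-∘ : ∀ {F G H : Graph} {g : V G → V H} {f : V F → V G} →
                 ReflexiveHom G H g → ReflexiveHom F G f → ReflexiveHom F H (g ∘ f)
ReflexiveHom-∘ {g = g} g-hom f-hom adj with f-hom adj
... | inj₁ same  = inj₁ (cong g same)
... | inj₂ adj′  = g-hom adj′

adjacent⇒distinct : ∀ {u v} → Adj G u v ≡ true → u ≢ v
adjacent⇒distinct {G} {u} adj refl with () ← trans (sym adj) (irrAdj G u)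

singleton-independent : ∀ a → Independent H ⁅ a ⁆
singleton-independent {H} a x y x∈ y∈
  rewrite x∈⁅y⁆⇒x≡y a x∈ | x∈⁅y⁆⇒x≡y a y∈ = irrAdj H a

nonAdjacent⇒disconnected : ∀ {a b} → NonAdjacent H a b → Disconnected H ⁅ a ⁆ ⁅ b ⁆
nonAdjacent⇒disconnected {H} {a} {b} (a≢b , nonadj) = disjoint , independent
  where
  disjoint : Empty (⁅ a ⁆ ∩ ⁅ b ⁆)
  disjoint (x , x∈) with x∈p∩q⁻ ⁅ a ⁆ ⁅ b ⁆ x∈
  ... | x∈a , x∈b = a≢b (trans (sym (x∈⁅y⁆⇒x≡y a x∈a)) (x∈⁅y⁆⇒x≡y b x∈b))

  ∈pair : ∀ {x} → x ∈ ⁅ a ⁆ ∪ ⁅ b ⁆ → x ≡ a ⊎ x ≡ b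
  ∈pair x∈ = Sum.map (x∈⁅y⁆⇒x≡y a) (x∈⁅y⁆⇒x≡y b) (x∈p∪q⁻ ⁅ a ⁆ ⁅ b ⁆ x∈)

  independent : Independent H (⁅ a ⁆ ∪ ⁅ b ⁆)
  independent x y x∈ y∈ with ∈pair x∈ | ∈pair y∈
  ... | inj₁ refl | inj₁ refl = irrAdj H a
  ... | inj₁ refl | inj₂ refl = nonadj
  ... | inj₂ refl | inj₁ refl = trans (symAdj H b a) nonadj
  ... | inj₂ refl | inj₂ refl = irrAdj H b

complementHom⇒𝓕 : ∀ {G H} {g : V G → V H} → ComplementHom G H g →
                   InF H G (λ v → ⁅ g v ⁆) × (∀ v → 1 ≤ ∣ ⁅ g v ⁆ ∣)
complementHom⇒𝓕 {H = H} {g = g} hom =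
  ( (λ v → singleton-independent {H} (g v))
  , (λ u v u≢v nonadj → nonAdjacent⇒disconnected {H} (hom (u≢v , nonadj))) )
  , λ v → ≤-reflexive (sym (∣⁅x⁆∣≡1 (g v)))

1≤∣p∣⇒nonempty : ∀ {k} (p : Subset k) → 1 ≤ ∣ p ∣ → Nonempty p
1≤∣p∣⇒nonempty {k} p 1≤∣p∣ = decidable-stable (nonempty? p) λ empty →
  n≮0 (subst (1 ≤_) (trans (cong ∣_∣ (Empty-unique empty)) (∣⊥∣≡0 k)) 1≤∣p∣)

𝓕⇒complementHom : ∀ {G H} {f : V G → Subset (n H)} → InF H G f → (∀ v → 1 ≤ ∣ f v ∣) →
                   Σ[ g ∈ (V G → V H) ] ComplementHom G H g
𝓕⇒complementHom {G} {H} {f} (_ , disconnected) nonempty = g , hom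
  where
  g : V G → V H
  g v = proj₁ (1≤∣p∣⇒nonempty (f v) (nonempty v))

  g∈f : ∀ v → g v ∈ f v
  g∈f v = proj₂ (1≤∣p∣⇒nonempty (f v) (nonempty v))

  hom : ComplementHom G H g
  hom {u} {v} (u≢v , nonadj) with disconnected u v u≢v nonadj
  ... | disjoint , independent =
    (λ gu≡gv → disjoint (g u , x∈p∩q⁺ (g∈f u , subst (_∈ f v) (sym gu≡gv) (g∈f v))))
    , independent (g u) (g v) (x∈p∪q⁺ (inj₁ (g∈f u))) (x∈p∪q⁺ (inj₂ (g∈f v)))

include : (G : Graph) (w : V G) → V (removeVertex G w) → V G
include (mkGraph (suc _) _ _ _) w = punchIn w

exclude : (G : Graph) {w x : V G} → w ≢ x → V (removeVertex G w)
exclude (mkGraph (suc _) _ _ _) w≢x = punchOut w≢x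

include-adj : ∀ G w x y → Adj G (include G w x) (include G w y) ≡ Adj (removeVertex G w) x y
include-adj (mkGraph (suc _) _ _ _) w x y = refl

include-injective : ∀ G w {x y} → include G w x ≡ include G w y → x ≡ y
include-injective (mkGraph (suc _) _ _ _) w {x} {y} = punchIn-injective w x y

include≢ : ∀ G w x → include G w x ≢ w
include≢ (mkGraph (suc _) _ _ _) = punchInᵢ≢i

include-exclude : ∀ G {w x} (w≢x : w ≢ x) → include G w (exclude G w≢x) ≡ x
include-exclude (mkGraph (suc _) _ _ _) = punchIn-punchOut

include-complementHom : ∀ G w → ComplementHom (removeVertex G w) G (include G w)
include-complementHom G w {x} {y} (x≢y , nonadj) =
  x≢y ∘ include-injective G w , trans (include-adj G w x y) nonadj

↑ˡ≢↑ʳ : ∀ {m k} (a : Fin m) (j : Fin k) → a ↑ˡ k ≢ m ↑ʳ j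
↑ˡ≢↑ʳ {m} {k} a j eq
  with () ← trans (sym (splitAt-↑ˡ m a k)) (trans (cong (splitAt m) eq) (splitAt-↑ʳ m k j))

splitAt-injective : ∀ m {k} {X Y : Fin (m + k)} → splitAt m X ≡ splitAt m Y → X ≡ Y
splitAt-injective m {k} {X} {Y} eq =
  trans (sym (join-splitAt m k X)) (trans (cong (join m k) eq) (join-splitAt m k Y))

origin : ∀ G v k → V (addClique G v k) → V G
origin G v k X = [ id , const v ]′ (splitAt (n G) X)

origin-reflexiveHom : ∀ G v k → ReflexiveHom (addClique G v k) G (origin G v k)
origin-reflexiveHom G v k {X} {Y} adj with splitAt (n G) X | splitAt (n G) Y
... | inj₁ a | inj₁ b = inj₂ adj
... | inj₁ a | inj₂ _ = inj₂ (trans (symAdj G a v) adj)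
... | inj₂ _ | inj₁ b = inj₂ adj
... | inj₂ _ | inj₂ _ = inj₁ refl

origin-complementHom : ∀ G v k {X Y} → X ≢ v ↑ˡ k → Y ≢ v ↑ˡ k →
                       NonAdjacent (addClique G v k) X Y →
                       NonAdjacent G (origin G v k X) (origin G v k Y)
origin-complementHom G v k {X} {Y} X≢v Y≢v (X≢Y , nonadj)
  with splitAt (n G) X in eqX | splitAt (n G) Y in eqY
... | inj₁ a | inj₁ b =
  (λ { refl → X≢Y (splitAt-injective (n G) (trans eqX (sym eqY))) }) , nonadj
... | inj₁ a | inj₂ _ =
  (λ { refl → X≢v (splitAt-injective (n G) (trans eqX (sym (splitAt-↑ˡ (n G) v k)))) })
  , trans (symAdj G a v) nonadj
... | inj₂ _ | inj₁ b =
  (λ { refl → Y≢v (splitAt-injective (n G) (trans eqY (sym (splitAt-↑ˡ (n G) v k)))) }) , nonadj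
... | inj₂ i | inj₂ j with i ≟ j
...   | yes refl = ⊥-elim (X≢Y (splitAt-injective (n G) (trans eqX (sym eqY))))
origin-complementHom G v k X≢v Y≢v (X≢Y , ()) | inj₂ i | inj₂ j | no _

contract : ∀ G v k → V (replaceByClique G v k) → V G
contract G v k = origin G v k ∘ include (addClique G v k) (v ↑ˡ k)

contract-reflexiveHom : ∀ G v k → ReflexiveHom (replaceByClique G v k) G (contract G v k)
contract-reflexiveHom G v k {x} {y} adj =
  origin-reflexiveHom G v k (trans (include-adj (addClique G v k) (v ↑ˡ k) x y) adj)

contract-complementHom : ∀ G v k → ComplementHom (replaceByClique G v k) G (contract G v k)
contract-complementHom G v k {x} {y} nonadj =
  origin-complementHom G v k (include≢ G′ (v ↑ˡ k) x) (include≢ G′ (v ↑ˡ k) y)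
                             (include-complementHom G′ (v ↑ˡ k) nonadj)
  where G′ = addClique G v k

keep : ∀ G v k (a : V G) → a ≢ v → V (replaceByClique G v k)
keep G v k a a≢v = exclude (addClique G v k) (a≢v ∘ sym ∘ ↑ˡ-injective k v a)

clone : ∀ G v k → Fin k → V (replaceByClique G v k)
clone G v k j = exclude (addClique G v k) (↑ˡ≢↑ʳ v j)

contract-keep : ∀ G v k a (a≢v : a ≢ v) → contract G v k (keep G v k a a≢v) ≡ a
contract-keep G v k a a≢v = begin
  origin G v k (include (addClique G v k) (v ↑ˡ k) (keep G v k a a≢v))
    ≡⟨ cong (origin G v k) (include-exclude (addClique G v k) _) ⟩
  [ id , const v ]′ (splitAt (n G) (a ↑ˡ k))
    ≡⟨ cong [ id , const v ]′ (splitAt-↑ˡ (n G) a k) ⟩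
  a ∎
  where open ≡-Reasoning

contract-clone : ∀ G v k j → contract G v k (clone G v k j) ≡ v
contract-clone G v k j = begin
  origin G v k (include (addClique G v k) (v ↑ˡ k) (clone G v k j))
    ≡⟨ cong (origin G v k) (include-exclude (addClique G v k) _) ⟩
  [ id , const v ]′ (splitAt (n G) (n G ↑ʳ j))
    ≡⟨ cong [ id , const v ]′ (splitAt-↑ʳ (n G) k j) ⟩
  v ∎
  where open ≡-Reasoning

keep-injective : ∀ G v k {a b} (a≢v : a ≢ v) (b≢v : b ≢ v) →
                 keep G v k a a≢v ≡ keep G v k b b≢v → a ≡ b
keep-injective G v k a≢v b≢v eq =
  trans (sym (contract-keep G v k _ a≢v)) (trans (cong (contract G v k) eq) (contract-keep G v k _ b≢v))

keep≢clone : ∀ G v k {a} (a≢v : a ≢ v) j → keep G v k a a≢v ≢ clone G v k j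
keep≢clone G v k a≢v j eq =
  a≢v (trans (sym (contract-keep G v k _ a≢v)) (trans (cong (contract G v k) eq) (contract-clone G v k j)))

clone-injective : ∀ G v k {i j} → clone G v k i ≡ clone G v k j → i ≡ j
clone-injective G v k {i} {j} eq = ↑ʳ-injective (n G) i j (begin
  n G ↑ʳ i                                    ≡⟨ sym (include-exclude G′ (↑ˡ≢↑ʳ v i)) ⟩
  include G′ (v ↑ˡ k) (clone G v k i)         ≡⟨ cong (include G′ (v ↑ˡ k)) eq ⟩
  include G′ (v ↑ˡ k) (clone G v k j)         ≡⟨ include-exclude G′ (↑ˡ≢↑ʳ v j) ⟩
  n G ↑ʳ j                                    ∎)
  where open ≡-Reasoning
        G′ = addClique G v k

addEdge-adj⁺ : ∀ G u w (u≢w : u ≢ w) {x y} → Adj G x y ≡ true → Adj (addEdge G u w u≢w) x y ≡ true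
addEdge-adj⁺ G u w u≢w adj = cong (_∨ _) adj

addEdge-adj-new : ∀ G u w (u≢w : u ≢ w) → Adj (addEdge G u w u≢w) u w ≡ true
addEdge-adj-new G u w u≢w with Adj G u w | u ≟ u | w ≟ w
... | true  | _        | _        = refl
... | false | yes _    | yes _    = refl
... | false | no u≢u   | _        = contradiction refl u≢u
... | false | _        | no w≢w   = contradiction refl w≢w

addEdge-adj⁻ : ∀ G u w (u≢w : u ≢ w) {x y} → Adj (addEdge G u w u≢w) x y ≡ true →
               Adj G x y ≡ true ⊎ (x ≡ u × y ≡ w) ⊎ (x ≡ w × y ≡ u)
addEdge-adj⁻ G u w u≢w {x} {y} adj with Adj G x y | x ≟ u | y ≟ w | x ≟ w | y ≟ u
... | true  | _       | _       | _       | _       = inj₁ refl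
... | false | yes x≡u | yes y≡w | _       | _       = inj₂ (inj₁ (x≡u , y≡w))
... | false | _       | _       | yes x≡w | yes y≡u = inj₂ (inj₂ (x≡w , y≡u))
addEdge-adj⁻ G u w u≢w () | false | no _  | _    | no _  | _
addEdge-adj⁻ G u w u≢w () | false | no _  | _    | yes _ | no _
addEdge-adj⁻ G u w u≢w () | false | yes _ | no _ | no _  | _
addEdge-adj⁻ G u w u≢w () | false | yes _ | no _ | yes _ | no _

addEdge-complementHom : ∀ G u w (u≢w : u ≢ w) → ComplementHom (addEdge G u w u≢w) G id
addEdge-complementHom G u w u≢w {x} {y} (x≢y , nonadj) = x≢y , ∨-conicalˡ (Adj G x y) _ nonadj

Reach⇒complementHom : Reach H G → Σ[ g ∈ (V G → V H) ] ComplementHom G H g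
Reach⇒complementHom start = id , id
Reach⇒complementHom (opI {G} r w) with Reach⇒complementHom r
... | g , hom = g ∘ include G w , hom ∘ include-complementHom G w
Reach⇒complementHom (opII {G} r v k) with Reach⇒complementHom r
... | g , hom = g ∘ contract G v k , hom ∘ contract-complementHom G v k
Reach⇒complementHom (opIII {G} r u w u≢w) with Reach⇒complementHom r
... | g , hom = g , hom ∘ addEdge-complementHom G u w u≢w

≅-complementHom : (φ : G ≅ H) → ComplementHom H G (Inverse.from (_≅_.iso φ))
≅-complementHom {G} {H} φ {u} {v} (u≢v , nonadj) =
  (λ eq → u≢v (trans (sym (strictlyInverseˡ u)) (trans (cong to eq) (strictlyInverseˡ v))))
  , trans (presAdj (from u) (from v)) (trans (cong₂ (Adj H) (strictlyInverseˡ u) (strictlyInverseˡ v)) nonadj)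
  where open _≅_ φ
        open Inverse iso

Expand⇒complementHom : Expand H G → Σ[ g ∈ (V G → V H) ] ComplementHom G H g
Expand⇒complementHom (_ , r , φ) with Reach⇒complementHom r
... | g , hom = g ∘ Inverse.from (_≅_.iso φ) , hom ∘ ≅-complementHom φ

-- ℓ sends each vertex of B to the vertex of H it was cloned from; spare h is a descendant of h
-- used by no copy, so that h can still be cloned.
record BlowUp (H : Graph) {j : ℕ} (g : Fin j → V H) : Set where
  field
    B          : Graph
    reach      : Reach H B
    ℓ          : V B → V H
    ℓ-hom      : ReflexiveHom B H ℓ
    copy       : Fin j → V B
    copy-inj   : ∀ {s t} → copy s ≡ copy t → s ≡ t
    ℓ-copy     : ∀ t → ℓ (copy t) ≡ g t
    spare      : V H → V B
    ℓ-spare    : ∀ h → ℓ (spare h) ≡ h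
    copy≢spare : ∀ t h → copy t ≢ spare h

  spare-injective : ∀ {h h′} → spare h ≡ spare h′ → h ≡ h′
  spare-injective {h} {h′} eq = trans (sym (ℓ-spare h)) (trans (cong ℓ eq) (ℓ-spare h′))

blowUp-cons : ∀ {j} {g : Fin (suc j) → V H} → BlowUp H (g ∘ suc) → BlowUp H g
blowUp-cons {H} {j} {g} S = record
  { B          = B′
  ; reach      = opII reach w 2
  ; ℓ          = ℓ ∘ contract B w 2
  ; ℓ-hom      = ReflexiveHom-∘ {F = B′} {G = B} {H = H} ℓ-hom (contract-reflexiveHom B w 2)
  ; copy       = copy′
  ; copy-inj   = copy′-inj
  ; ℓ-copy     = ℓ-copy′
  ; spare      = λ h′ → spare′ h′ (h′ ≟ h)
  ; ℓ-spare    = λ h′ → ℓ-spare′ h′ (h′ ≟ h)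
  ; copy≢spare = λ t h′ → copy′≢spare′ t h′ (h′ ≟ h)
  }
  where
  open BlowUp S
  h = g zero
  w = spare h
  B′ = replaceByClique B w 2

  copy≢w : ∀ t → copy t ≢ w
  copy≢w t = copy≢spare t h

  spare≢w : ∀ {h′} → h′ ≢ h → spare h′ ≢ w
  spare≢w h′≢h = h′≢h ∘ spare-injective

  copy′ : Fin (suc j) → V B′
  copy′ zero    = clone B w 2 (suc zero)
  copy′ (suc t) = keep B w 2 (copy t) (copy≢w t)

  spare′ : ∀ h′ → Dec (h′ ≡ h) → V B′
  spare′ h′ (yes _)    = clone B w 2 zero
  spare′ h′ (no h′≢h)  = keep B w 2 (spare h′) (spare≢w h′≢h)

  copy′-inj : ∀ {s t} → copy′ s ≡ copy′ t → s ≡ t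
  copy′-inj {zero}  {zero}  _  = refl
  copy′-inj {zero}  {suc t} eq = ⊥-elim (keep≢clone B w 2 (copy≢w t) _ (sym eq))
  copy′-inj {suc s} {zero}  eq = ⊥-elim (keep≢clone B w 2 (copy≢w s) _ eq)
  copy′-inj {suc s} {suc t} eq = cong suc (copy-inj (keep-injective B w 2 (copy≢w s) (copy≢w t) eq))

  ℓ-copy′ : ∀ t → ℓ (contract B w 2 (copy′ t)) ≡ g t
  ℓ-copy′ zero    = trans (cong ℓ (contract-clone B w 2 (suc zero))) (ℓ-spare h)
  ℓ-copy′ (suc t) = trans (cong ℓ (contract-keep B w 2 (copy t) (copy≢w t))) (ℓ-copy t)

  ℓ-spare′ : ∀ h′ d → ℓ (contract B w 2 (spare′ h′ d)) ≡ h′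
  ℓ-spare′ h′ (yes h′≡h) = trans (cong ℓ (contract-clone B w 2 zero)) (trans (ℓ-spare h) (sym h′≡h))
  ℓ-spare′ h′ (no h′≢h)  = trans (cong ℓ (contract-keep B w 2 (spare h′) (spare≢w h′≢h))) (ℓ-spare h′)

  copy′≢spare′ : ∀ t h′ d → copy′ t ≢ spare′ h′ d
  copy′≢spare′ zero    h′ (yes _)    eq with () ← clone-injective B w 2 eq
  copy′≢spare′ zero    h′ (no h′≢h)  eq = keep≢clone B w 2 (spare≢w h′≢h) _ (sym eq)
  copy′≢spare′ (suc t) h′ (yes _)    eq = keep≢clone B w 2 (copy≢w t) _ eq
  copy′≢spare′ (suc t) h′ (no h′≢h)  eq =
    copy≢spare t h′ (keep-injective B w 2 (copy≢w t) (spare≢w h′≢h) eq)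

blowUp : ∀ H j (g : Fin j → V H) → BlowUp H g
blowUp H zero    g = record
  { B = H ; reach = start ; ℓ = id ; ℓ-hom = inj₂
  ; copy = λ () ; copy-inj = λ { {()} } ; ℓ-copy = λ ()
  ; spare = id ; ℓ-spare = λ _ → refl ; copy≢spare = λ () }
blowUp H (suc j) g = blowUp-cons (blowUp H j (g ∘ suc))

module _ {G H : Graph} {g : V G → V H} (g-hom : ComplementHom G H g) (S : BlowUp H g) where
  open BlowUp S

  copy-reflects : ∀ {x y} → Adj B (copy x) (copy y) ≡ true → Adj G x y ≡ true
  copy-reflects {x} {y} adj with Adj G x y in nonadj
  ... | true  = refl
  ... | false with ℓ-hom adj | g-hom (adjacent⇒distinct {B} adj ∘ cong copy , nonadj)
  ...   | inj₁ same | differ , _ = ⊥-elim (differ (trans (sym (ℓ-copy x)) (trans same (ℓ-copy y))))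
  ...   | inj₂ adjH | _ , nonadjH
    with () ← trans (sym nonadjH) (subst₂ (λ a b → Adj H a b ≡ true) (ℓ-copy x) (ℓ-copy y) adjH)

ReachableRestriction : (H G : Graph) {k : ℕ} → (Fin k → Fin k → Bool) → (V G → Fin k) → Set
ReachableRestriction H G A e =
  Σ[ B ∈ Graph ] Reach H B × Σ[ φ ∈ V B ↔ V G ]
    (∀ u v → Adj B u v ≡ A (e (Inverse.to φ u)) (e (Inverse.to φ v)))

restrict : ∀ {G k A s i} → Reach H (mkGraph k A s i) →
           (e : V G → Fin k) → (∀ {x y} → e x ≡ e y → x ≡ y) → ReachableRestriction H G A e
restrict {G = G} {k} {A} r e e-inj with all? (λ w → any? (λ x → e x ≟ w))
... | yes surjective =
  _ , r , mk↔ₛ′ e⁻¹ e (e-inj ∘ e-e⁻¹ ∘ e) e-e⁻¹ , λ u v → sym (cong₂ A (e-e⁻¹ u) (e-e⁻¹ v))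
  where
  e⁻¹ : Fin k → V G
  e⁻¹ w = proj₁ (surjective w)
  e-e⁻¹ : ∀ w → e (e⁻¹ w) ≡ w
  e-e⁻¹ w = proj₂ (surjective w)
... | no ¬surjective with ¬∀⟶∃¬ k _ (λ w → any? (λ x → e x ≟ w)) ¬surjective
restrict {H} {G} {suc k} {A} {s} {i} r e e-inj | no _ | w , missed =
  lift (restrict {G = G} (opI r w) e′ (e-inj ∘ punchOut-injective (w≢e _) (w≢e _)))
  where
  B = mkGraph (suc k) A s i

  w≢e : ∀ x → w ≢ e x
  w≢e x eq = missed (x , sym eq)

  e′ : V G → V (removeVertex B w)
  e′ = exclude B ∘ w≢e

  lift : ReachableRestriction H G (Adj (removeVertex B w)) e′ → ReachableRestriction H G A e
  lift (B′ , r′ , φ , adj) = B′ , r′ , φ , λ u v →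
    trans (adj u v) (cong₂ A (include-exclude B (w≢e _)) (include-exclude B (w≢e _)))

module _ {G : Graph} {k : ℕ} (φ : Fin k ↔ V G) where
  open Inverse φ using (to)

  saturate : (L : List (Fin k × Fin k)) → ∀ {A s i} → Reach H (mkGraph k A s i) →
             (∀ u v → A u v ≡ true → Adj G (to u) (to v) ≡ true) →
             (∀ u v → Adj G (to u) (to v) ≡ true → A u v ≡ true ⊎ (u , v) ∈ₗ L) →
             Expand H G
  saturate [] {A} {s} {i} r A⊆G G⊆A = mkGraph k A s i , r , record
    { iso = φ
    ; presAdj = λ u v → ⇔→≡ (mk⇔ (A⊆G u v) (λ adj → [ id , (λ ()) ]′ (G⊆A u v adj)))
    }
  saturate ((u , v) ∷ L) {A} {s} {i} r A⊆G G⊆A with Adj G (to u) (to v) in uv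
  ... | false = saturate L r A⊆G G⊆A′
    where
    G⊆A′ : ∀ x y → Adj G (to x) (to y) ≡ true → A x y ≡ true ⊎ (x , y) ∈ₗ L
    G⊆A′ x y adj with G⊆A x y adj
    ... | inj₁ a              = inj₁ a
    ... | inj₂ (there xy∈L)   = inj₂ xy∈L
    ... | inj₂ (here refl)    with () ← trans (sym uv) adj
  ... | true = saturate L (opIII r u v u≢v) A⊆G′ G⊆A′
    where
    B = mkGraph k A s i

    u≢v : u ≢ v
    u≢v = adjacent⇒distinct {G} uv ∘ cong to

    A⊆G′ : ∀ x y → Adj (addEdge B u v u≢v) x y ≡ true → Adj G (to x) (to y) ≡ true
    A⊆G′ x y adj with addEdge-adj⁻ B u v u≢v adj
    ... | inj₁ a                       = A⊆G x y a
    ... | inj₂ (inj₁ (refl , refl))    = uv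
    ... | inj₂ (inj₂ (refl , refl))    = trans (symAdj G (to x) (to y)) uv

    G⊆A′ : ∀ x y → Adj G (to x) (to y) ≡ true → Adj (addEdge B u v u≢v) x y ≡ true ⊎ (x , y) ∈ₗ L
    G⊆A′ x y adj with G⊆A x y adj
    ... | inj₁ a              = inj₁ (addEdge-adj⁺ B u v u≢v a)
    ... | inj₂ (there xy∈L)   = inj₂ xy∈L
    ... | inj₂ (here refl)    = inj₁ (addEdge-adj-new B u v u≢v)

reflectingInjection⇒Expand : ∀ {B} → Reach H B → (e : V G → V B) → (∀ {x y} → e x ≡ e y → x ≡ y) →
                             (∀ {x y} → Adj B (e x) (e y) ≡ true → Adj G x y ≡ true) →
                             Expand H G
reflectingInjection⇒Expand {G = G} r e e-inj reflects with restrict {G = G} r e e-inj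
... | B′ , r′ , φ , adj =
  saturate φ (cartesianProduct (allFin _) (allFin _)) r′
    (λ u v a → reflects (trans (sym (adj u v)) a))
    (λ u v _ → inj₂ (∈-cartesianProduct⁺ (∈-allFin u) (∈-allFin v)))

complementHom⇒Expand : ∀ {G H} {g : V G → V H} → ComplementHom G H g → Expand H G
complementHom⇒Expand {G} {H} {g} g-hom =
  reflectingInjection⇒Expand reach copy copy-inj (copy-reflects {G} {H} g-hom S)
  where
  S = blowUp H (n G) g
  open BlowUp S

lemma6 : (G H : Graph) →
    Expand H G ⇔ (Σ[ f ∈ (V G → Subset (n H)) ] (InF H G f × (∀ v → 1 ≤ ∣ f v ∣)))
lemma6 G H = mk⇔
  (λ G∈Expand → _ , complementHom⇒𝓕 {G} {H} (proj₂ (Expand⇒complementHom G∈Expand)))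
  (λ (f , f∈𝓕 , f-nonempty) →
     complementHom⇒Expand {G} {H} (proj₂ (𝓕⇒complementHom {G} {H} f∈𝓕 f-nonempty)))
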